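{- For every PLTL formula $A$, the resolution algorithm described in the context, applied to $A$, terminates.
   Context: PLTL formulae are built from proposition symbols, $\mathbf{true}$, $\mathbf{false}$, $\neg,\vee,\wedge,\Rightarrow$ and temporal operators $\bigcirc,\Diamond,\Box,\mathcal{U},\mathcal{W}$ (next, sometime, always, until, unless) with the standard discrete linear-time semantics over models $\sigma=s_0,s_1,\dots$ (sequences of sets of proposition symbols); $\mathbf{start}$ holds exactly at index $0$. A literal is a proposition symbol or its negation. A PLTL-clause has one of the forms $\mathbf{start}\Rightarrow\bigvee_c l_c$ (initial), $\bigwedge_a k_a\Rightarrow\bigcirc\bigvee_d l_d$ (step), $\bigwedge_b k_b\Rightarrow\Diamond l$ (sometime), all $k,l$ literals; a clause set $\{A_i\}$ denotes $\Box\bigwedge_iA_i$. The literal $l$ of a sometime clause is an eventuality literal; $\neg C$ for a conjunction of literals $C$ is the disjunction of the complementary literals. The algorithm: (1) translate $A$ into a set $A_s$ of PLTL-clauses by the SNF translation $\tau_0$ (a renaming-based translation introducing finitely many new proposition symbols); (2) form the augmentation $Aug(A_s)$: for each eventuality literal $l$ introduce a new proposition symbol $w_l$ and add $w_l\Rightarrow\bigcirc(l\vee w_l)$, and for each sometime clause $C\Rightarrow\Diamond l$ add $\mathbf{start}\Rightarrow\neg C\vee l\vee w_l$ and $\mathbf{true}\Rightarrow\bigcirc(\neg C\vee l\vee w_l)$; (3) perform step resolution, together with simplification and subsumption, until either $\mathbf{start}\Rightarrow\mathbf{false}$ is derived (terminate: unsatisfiable) or no new resolvents are generated; (4) select an eventuality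 $\Diamond l$ from a sometime clause and search for loops in $\neg l$; (5) construct the loop resolvents for the loops found and each sometime clause with right-hand side $\Diamond l$; if any new clause (not subsumed by clauses present) is generated go to (3); (6) if all eventualities have been resolved, terminate declaring $A$ satisfiable, otherwise go to (4). Here: step resolution derives $\mathbf{start}\Rightarrow A\vee B$ from $\mathbf{start}\Rightarrow A\vee p$ and $\mathbf{start}\Rightarrow B\vee\neg p$, and $(C\wedge D)\Rightarrow\bigcirc(A\vee B)$ from $C\Rightarrow\bigcirc(A\vee p)$ and $D\Rightarrow\bigcirc(B\vee\neg p)$; a clause $A\Rightarrow\bigcirc\mathbf{false}$ is replaced by $\mathbf{start}\Rightarrow\neg A$ and $\mathbf{true}\Rightarrow\bigcirc\neg A$. Simplification removes duplicate literals, replaces clauses with complementary literals on the left by $\mathbf{false}\Rightarrow\bigcirc B$ and on the right by $A\Rightarrow\bigcirc\mathbf{true}$, removes $\mathbf{true}$ from conjunctions and $\mathbf{false}$ from disjunctions (with $\mathbf{false}$ in a left conjunction giving $\mathbf{false}\Rightarrow\bigcirc B$ and $\mathbf{true}$ in a right disjunction giving $A\Rightarrow\bigcirc\mathbf{true}$), and deletes clauses $\mathbf{false}\Rightarrow\bigcirc A$ and $A\Rightarrow\bigcirc\mathbf{true}$. Subsumption deletes $C\Rightarrow A$ if $D\Rightarrow B$ is present with $\vdash C\Rightarrow D$, $\vdash B\Rightarrow A$. SNF$_m$ clauses: step clauses, and $(A\wedge B)\Rightarrow\bigcirc(C\wedge D)$ formed from SNF$_m$ clauses $A\Rightarrow\bigcirc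 C$, $B\Rightarrow\bigcirc D$. A loop in $\neg l$ is a family of SNF$_m$ clauses $A_i\Rightarrow\bigcirc B_i$ ($0\le i\le n$) formed from step clauses of the current set with $B_i\Rightarrow\neg l$ and $B_i\Rightarrow\bigvee_j A_j$ propositional tautologies for all $i$. Its loop resolvents with $C\Rightarrow\Diamond l$ are, for each $i$, $\mathbf{start}\Rightarrow\neg C\vee l\vee\neg A_i$, $\mathbf{true}\Rightarrow\bigcirc(\neg C\vee l\vee\neg A_i)$ and $w_l\Rightarrow\bigcirc(l\vee\neg A_i)$. -}

module Defs where

open import Data.Nat using (ℕ; zero; suc; _+_; _*_; _⊔_)
open import Data.Nat.Properties using () renaming (_≟_ to _≟ℕ_)
open import Data.Bool using (Bool; true; false; not; _∧_; _∨_; if_then_else_)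
open import Data.List using (List; []; _∷_; _++_; map; concatMap; foldr; length; lookup; removeAt; deduplicateᵇ)
open import Data.List.NonEmpty using (List⁺; toList)
open import Data.List.Membership.Propositional using (_∈_; _∉_)
open import Data.List.Relation.Unary.Any using (Any)
open import Data.List.Relation.Unary.All using (All)
open import Data.Fin using (Fin)
open import Data.Product using (_×_; _,_; proj₁; proj₂; Σ; ∃)
open import Data.Sum using (_⊎_)
open import Data.Empty using (⊥)
open import Data.Unit using (⊤)
open import Relation.Nullary using (¬_; does)
open import Relation.Binary.PropositionalEquality using (_≡_; _≢_)
open import Relation.Binary.Construct.Closure.ReflexiveTransitive using (Star)
open import Induction.WellFounded using (Acc)

data Formula : Set where
  prop             : ℕ → Formula
  `true `false     : Formula
  `¬_              : Formula → Formula
  _`∨_ _`∧_ _`⇒_   : Formula → Formula → Formula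
  `○_ `◇_ `□_      : Formula → Formula
  _`U_ _`W_        : Formula → Formula → Formula

data Lit : Set where
  pos neg : ℕ → Lit

comp : Lit → Lit
comp (pos n) = neg n
comp (neg n) = pos n

symOf : Lit → ℕ
symOf (pos n) = n
symOf (neg n) = n

eqL : Lit → Lit → Bool
eqL (pos m) (pos n) = does (m ≟ℕ n)
eqL (neg m) (neg n) = does (m ≟ℕ n)
eqL _       _       = false

memL : Lit → List Lit → Bool
memL l []       = false
memL l (x ∷ xs) = eqL l x ∨ memL l xs

removeL : Lit → List Lit → List Lit
removeL l []       = []
removeL l (x ∷ xs) = if eqL x l then removeL l xs else x ∷ removeL l xs

dedupL : List Lit → List Lit
dedupL = deduplicateᵇ eqL

hasComp : List Lit → Bool
hasComp []       = false
hasComp (x ∷ xs) = memL (comp x) xs ∨ hasComp xs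

-- ¬C for a conjunction C of literals: disjunction of the complements
negC : List Lit → List Lit
negC = map comp

-- PLTL-clauses.
--   init D    : start ⇒ ⋁ D        (init [] is start ⇒ false)
--   step C D  : ⋀ C ⇒ ○ ⋁ D        (step [] D is true ⇒ ○ ⋁ D,
--                                   step C [] is ⋀ C ⇒ ○ false)
--   some C l  : ⋀ C ⇒ ◇ l

data Clause : Set where
  init : List Lit → Clause
  step : List Lit → List Lit → Clause
  some : List Lit → Lit → Clause

data PF : Set where
  atom      : ℕ → PF
  tt ff     : PF
  _⇒'_ _∧'_ _∨'_ : PF → PF → PF

⟦_⟧ : PF → (ℕ → Bool) → Bool
⟦ atom n ⟧ v = v n
⟦ tt ⟧ v = true
⟦ ff ⟧ v = false
⟦ φ ⇒' ψ ⟧ v = not (⟦ φ ⟧ v) ∨ ⟦ ψ ⟧ v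
⟦ φ ∧' ψ ⟧ v = ⟦ φ ⟧ v ∧ ⟦ ψ ⟧ v
⟦ φ ∨' ψ ⟧ v = ⟦ φ ⟧ v ∨ ⟦ ψ ⟧ v

Taut : PF → Set
Taut φ = ∀ (v : ℕ → Bool) → ⟦ φ ⟧ v ≡ true

litF : Lit → PF
litF (pos n) = atom n
litF (neg n) = atom n ⇒' ff

conjF : List Lit → PF
conjF = foldr (λ l φ → litF l ∧' φ) tt

disjF : List Lit → PF
disjF = foldr (λ l φ → litF l ∨' φ) ff

-- conjunction of disjunctions (right-hand sides of SNF_m clauses)
cnfF : List (List Lit) → PF
cnfF = foldr (λ D φ → disjF D ∧' φ) tt

dnfF : List (List Lit) → PF
dnfF = foldr (λ C φ → conjF C ∨' φ) ff

Subsumes : Clause → Clause → Set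
Subsumes (init B)   (init A)   = Taut (disjF B ⇒' disjF A)
Subsumes (step D B) (step C A) = Taut (conjF C ⇒' conjF D) × Taut (disjF B ⇒' disjF A)
Subsumes (some D k) (some C l) = Taut (conjF C ⇒' conjF D) × Taut (litF k ⇒' litF l)
Subsumes _          _          = ⊥

SubsumedBy : List Clause → Clause → Set
SubsumedBy S c = Any (λ d → Subsumes d c) S

-- Simplification of a (newly generated) clause; the result is the list of
-- clauses that replace it (empty when the clause is deleted).

simp : Clause → List Clause
simp (init A)   = init (dedupL A) ∷ []
simp (step C A) with hasComp C | hasComp A | dedupL A
... | true  | _     | _       = []      -- false ⇒ ○ B : deleted
... | false | true  | _       = []      -- A ⇒ ○ true : deleted
... | false | false | []      = init (negC (dedupL C)) ∷ step [] (negC (dedupL C)) ∷ []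
                                          -- A ⇒ ○ false replaced
... | false | false | A'@(_ ∷ _) = step (dedupL C) A' ∷ []
simp (some C l) = some (dedupL C) l ∷ []

data Resolvent (S : List Clause) : Clause → Set where
  init-res : ∀ {A B} (p : Lit) → init A ∈ S → init B ∈ S → p ∈ A → comp p ∈ B →
             Resolvent S (init (removeL p A ++ removeL (comp p) B))
  step-res : ∀ {C A D B} (p : Lit) → step C A ∈ S → step D B ∈ S → p ∈ A → comp p ∈ B →
             Resolvent S (step (C ++ D) (removeL p A ++ removeL (comp p) B))

Saturated : List Clause → Set
Saturated S = ∀ {r} → Resolvent S r → ∀ {d} → d ∈ simp r → SubsumedBy S d

-- SNF_m clauses  ⋀ A ⇒ ○ ⋀_k ⋁ B_k  formed from step clauses of S

data SNFm (S : List Clause) : List Lit → List (List Lit) → Set where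
  base : ∀ {A B} → step A B ∈ S → SNFm S A (B ∷ [])
  comb : ∀ {A B C D} → SNFm S A C → SNFm S B D → SNFm S (A ++ B) (C ++ D)

-- a loop in ¬l : nonempty family A_i ⇒ ○ B_i of SNF_m clauses with
-- ⊢ B_i ⇒ ¬l and ⊢ B_i ⇒ ⋁_j A_j for all i
LoopMember : List Clause → Lit → List (List Lit) → List Lit × List (List Lit) → Set
LoopMember S l As (A , B) =
  SNFm S A B × Taut (cnfF B ⇒' litF (comp l)) × Taut (cnfF B ⇒' dnfF As)

IsLoop : List Clause → Lit → List⁺ (List Lit × List (List Lit)) → Set
IsLoop S l L = All (LoopMember S l (map proj₁ (toList L))) (toList L)

-- loop resolvents of a loop L with C ⇒ ◇ l, where wl is the symbol w_l
loopRes : List Lit → Lit → ℕ → List⁺ (List Lit × List (List Lit)) → List Clause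
loopRes C l wl L = concatMap
  (λ AB → init (negC C ++ l ∷ negC (proj₁ AB))
        ∷ step [] (negC C ++ l ∷ negC (proj₁ AB))
        ∷ step (pos wl ∷ []) (l ∷ negC (proj₁ AB)) ∷ [])
  (toList L)

sometimesFor : Lit → List Clause → List (List Lit)
sometimesFor l []                = []
sometimesFor l (some C k ∷ S)    = if eqL k l then C ∷ sometimesFor l S else sometimesFor l S
sometimesFor l (init _ ∷ S)      = sometimesFor l S
sometimesFor l (step _ _ ∷ S)    = sometimesFor l S

allLoopRes : List Clause → Lit → ℕ → List (List⁺ (List Lit × List (List Lit))) → List Clause
allLoopRes S l wl Ls =
  concatMap simp (concatMap (λ C → concatMap (loopRes C l wl) Ls) (sometimesFor l S))

-- Augmentation.  New symbols w_l are chosen above every symbol of A_s: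
-- with N = 1 + (largest symbol of A_s), w_{pos n} = N + 2n, w_{neg n} = N + 2n + 1.

maxLits : List Lit → ℕ
maxLits = foldr (λ l m → symOf l ⊔ m) 0

maxSym : List Clause → ℕ
maxSym []               = 0
maxSym (init A ∷ S)     = maxLits A ⊔ maxSym S
maxSym (step C A ∷ S)   = maxLits C ⊔ maxLits A ⊔ maxSym S
maxSym (some C l ∷ S)   = maxLits C ⊔ symOf l ⊔ maxSym S

wSym : ℕ → Lit → ℕ
wSym N (pos n) = N + 2 * n
wSym N (neg n) = N + suc (2 * n)

someClauses : List Clause → List (List Lit × Lit)
someClauses []             = []
someClauses (some C l ∷ S) = (C , l) ∷ someClauses S
someClauses (init _ ∷ S)   = someClauses S
someClauses (step _ _ ∷ S) = someClauses S

eventualities : List Clause → List Lit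
eventualities S = dedupL (map proj₂ (someClauses S))

Aug : ℕ → List Clause → List Clause
Aug N As =
  As
  ++ map (λ l → step (pos (wSym N l) ∷ []) (l ∷ pos (wSym N l) ∷ [])) (eventualities As)
  ++ concatMap (λ Cl → init (negC (proj₁ Cl) ++ proj₂ Cl ∷ pos (wSym N (proj₂ Cl)) ∷ [])
                     ∷ step [] (negC (proj₁ Cl) ++ proj₂ Cl ∷ pos (wSym N (proj₂ Cl)) ∷ [])
                     ∷ [])
               (someClauses As)

-- The algorithm as a transition system.
--   phase3 N S   : at step (3) with current clause set S (N = base of w-symbols)
--   phase4 N S R : S saturated, at steps (4)-(6); R = eventualities already
--                  resolved (loop search produced no new clause) since S
--                  was last saturated
--   unsat / sat  : terminated with the corresponding answer

data State : Set where
  phase3 : ℕ → List Clause → State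
  phase4 : ℕ → List Clause → List Lit → State
  unsat sat : State

data _⟶_ : State → State → Set where
  derived-false : ∀ {N S} → init [] ∈ S → phase3 N S ⟶ unsat
  resolve : ∀ {N S r d} → init [] ∉ S → Resolvent S r → d ∈ simp r → ¬ SubsumedBy S d →
            phase3 N S ⟶ phase3 N (d ∷ S)
  subsume : ∀ {N S} (i j : Fin (length S)) → i ≢ j → Subsumes (lookup S j) (lookup S i) →
            phase3 N S ⟶ phase3 N (removeAt S i)
  saturated : ∀ {N S} → init [] ∉ S → Saturated S → phase3 N S ⟶ phase4 N S []
  loop-new : ∀ {N S R C l} (Ls : List (List⁺ (List Lit × List (List Lit)))) →
             some C l ∈ S → l ∉ R → All (IsLoop S l) Ls →
             Any (λ d → ¬ SubsumedBy S d) (allLoopRes S l (wSym N l) Ls) →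
             phase4 N S R ⟶ phase3 N (allLoopRes S l (wSym N l) Ls ++ S)
  loop-old : ∀ {N S R C l} (Ls : List (List⁺ (List Lit × List (List Lit)))) →
             some C l ∈ S → l ∉ R → All (IsLoop S l) Ls →
             All (SubsumedBy S) (allLoopRes S l (wSym N l) Ls) →
             phase4 N S R ⟶ phase4 N S (l ∷ R)
  all-resolved : ∀ {N S R} → (∀ {C l} → some C l ∈ S → l ∈ R) → phase4 N S R ⟶ sat

Final : State → Set
Final unsat        = ⊤
Final sat          = ⊤
Final (phase3 _ _)   = ⊥
Final (phase4 _ _ _) = ⊥

-- The algorithm terminates from s: every run from s is finite, and every
-- state reachable from s is either final or can make a further step.
Terminates : State → Set
Terminates s =
  Acc (λ t u → u ⟶ t) s
  × (∀ t → Star _⟶_ s t → Final t ⊎ ∃ (λ u → t ⟶ u))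

initialState : List Clause → State
initialState As = phase3 N (Aug N As)
  where N = suc (maxSym As)

module Submission where

-- Let N exceed every proposition symbol of τ₀ A.  Every clause of every reachable
-- state has its literals below 3N and its eventuality below N, since the w-symbols
-- of eventualities below N lie below 3N.  Up to mutual subsumption there are then
-- only finitely many clauses (normalise a clause to the literals below 3N that it
-- mentions), so the number of normal forms not yet subsumed by the current clause
-- set is a natural number.  No step increases it, and adding a new (not subsumed)
-- resolvent or loop resolvent strictly decreases it.  In between, deleting a
-- subsumed clause shortens the clause set and resolving an eventuality shrinks the
-- set of unresolved sometime clauses, so a lexicographic rank decreases along every
-- step.  A non-final state can always step, because tautology, subsumption and
-- saturation are decidable.

open import Defs
open import Data.Bool using (Bool; true; false; not; _∧_; _∨_)
import Data.Bool as Bool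
open import Data.Fin using (Fin; toℕ; fromℕ<)
import Data.Fin as Fin
open import Data.Fin.Properties using (toℕ-fromℕ<)
open import Data.Fin.Subset.Properties using (anySubset?)
open import Data.List
  using (List; []; _∷_; _++_; map; concat; concatMap; cartesianProductWith; filter; length; lookup; removeAt; upTo)
open import Data.List.NonEmpty using (toList)
open import Data.List.Properties using (length-removeAt′)
open import Data.List.Membership.Propositional using (_∈_; _∉_; find; lose)
open import Data.List.Membership.Propositional.Properties
  using (∈-map⁺; ∈-map⁻; ∈-filter⁺; ∈-filter⁻; ∈-++⁺ˡ; ∈-++⁺ʳ; ∈-concat⁺′; ∈-concat⁻′;
         ∈-concatMap⁺;
         ∈-cartesianProductWith⁺; ∈-cartesianProductWith⁻; ∈-upTo⁺; ∈-deduplicate⁻; ∈-lookup)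
open import Data.List.Relation.Binary.Subset.Propositional using (_⊆_)
open import Data.List.Relation.Binary.Subset.Propositional.Properties using (Any-resp-⊆; xs⊆x∷xs; xs⊆ys++xs)
open import Data.List.Relation.Unary.All as All using (All; []; _∷_; all?)
open import Data.List.Relation.Unary.All.Properties using (++⁺; map⁺; concat⁺; anti-mono; ¬All⇒Any¬)
open import Data.List.Relation.Unary.Any as Any using (Any; here; there; any?)
open import Data.List.Relation.Unary.Any.Properties using (lookup-result)
open import Data.Nat using (ℕ; zero; suc; _<_; _≤_; _⊔_; _<?_; z≤n; s≤s; z<s)
import Data.Nat as ℕ
open import Data.Nat.Induction using (<-wellFounded)
open import Data.Nat.Properties
  using (≤-refl; ≤-reflexive; ≤-antisym; <-≤-trans; m≤n⇒m≤1+n; m<n⇒m<n⊔o; m<n⇒m<o⊔n;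
         m⊔n<o⇒m<o; m⊔n<o⇒n<o; m≤n*m; +-monoʳ-<; *-monoʳ-<; *-monoʳ-≤; *-suc)
open import Data.Product using (_×_; _,_; proj₁; proj₂; ∃; ∃₂; uncurry)
open import Data.Product.Relation.Binary.Lex.Strict using (×-Lex; ×-wellFounded)
open import Data.Sum using (_⊎_; inj₁; inj₂)
open import Data.Empty using (⊥)
open import Data.Unit using (⊤; tt)
open import Data.Vec using (Vec; tabulate)
import Data.Vec as Vec
open import Data.Vec.Properties using (lookup∘tabulate)
open import Function using (_∘_; _∘₂_; flip)
open import Induction.WellFounded using (Acc; acc; WellFounded)
open import Relation.Binary.Definitions using (DecidableEquality)
open import Relation.Binary.PropositionalEquality
  using (_≡_; _≢_; refl; sym; trans; cong; cong₂; subst; module ≡-Reasoning)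
open import Relation.Nullary using (¬_; Dec; yes; no; does; ¬?; _×-dec_; contradiction)
open import Relation.Nullary.Decidable using (T?; decidable-stable)
import Relation.Nullary.Decidable as Dec
open import Relation.Unary using (Decidable)

private
  variable
    X Y : Set
    k M N : ℕ
    v : ℕ → Bool
    A B C : List Lit
    l : Lit
    S S′ : List Clause
    R : List Lit
    c d r : Clause

concatMap⁺ : {P : X → Set} {Q : Y → Set} {f : Y → List X} {ys : List Y} →
             (∀ {y} → Q y → All P (f y)) → All Q ys → All P (concatMap f ys)
concatMap⁺ h = concat⁺ ∘ map⁺ ∘ All.map h

sublists : List X → List (List X)
sublists []       = [] ∷ []
sublists (x ∷ xs) = map (x ∷_) (sublists xs) ++ sublists xs

filter-∈-sublists : {P : X → Set} (P? : Decidable P) → ∀ xs → filter P? xs ∈ sublists xs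
filter-∈-sublists P? [] = here refl
filter-∈-sublists P? (x ∷ xs) with does (P? x)
... | true  = ∈-++⁺ˡ (∈-map⁺ (x ∷_) (filter-∈-sublists P? xs))
... | false = ∈-++⁺ʳ _ (filter-∈-sublists P? xs)

removeAt-⊆ : ∀ (xs : List X) i → removeAt xs i ⊆ xs
removeAt-⊆ (x ∷ xs) Fin.zero    = there
removeAt-⊆ (x ∷ xs) (Fin.suc i) (here eq) = here eq
removeAt-⊆ (x ∷ xs) (Fin.suc i) (there m) = there (removeAt-⊆ xs i m)

lookup-∈-removeAt : ∀ (xs : List X) {i j} → j ≢ i → lookup xs j ∈ removeAt xs i
lookup-∈-removeAt (x ∷ xs) {Fin.zero}  {Fin.zero}  j≢i = contradiction refl j≢i
lookup-∈-removeAt (x ∷ xs) {Fin.zero}  {Fin.suc j} j≢i = ∈-lookup {xs = xs} j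
lookup-∈-removeAt (x ∷ xs) {Fin.suc i} {Fin.zero}  j≢i = here refl
lookup-∈-removeAt (x ∷ xs) {Fin.suc i} {Fin.suc j} j≢i = there (lookup-∈-removeAt xs (j≢i ∘ cong Fin.suc))

count : {P : X → Set} → Decidable P → List X → ℕ
count P? xs = length (filter P? xs)

module _ {P Q : X → Set} (P? : Decidable P) (Q? : Decidable Q) (Q⇒P : ∀ {x} → Q x → P x) where

  count-mono : ∀ xs → count Q? xs ≤ count P? xs
  count-mono [] = z≤n
  count-mono (x ∷ xs) with P? x | Q? x
  ... | yes _ | yes _ = s≤s (count-mono xs)
  ... | yes _ | no  _ = m≤n⇒m≤1+n (count-mono xs)
  ... | no ¬p | yes q = contradiction (Q⇒P q) ¬p
  ... | no  _ | no  _ = count-mono xs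

  count-mono-< : ∀ {x xs} → x ∈ xs → P x → ¬ Q x → count Q? xs < count P? xs
  count-mono-< {xs = y ∷ xs} (here refl) p ¬q with P? y | Q? y
  ... | yes _ | no  _ = s≤s (count-mono xs)
  ... | _     | yes q = contradiction q ¬q
  ... | no ¬p | _     = contradiction p ¬p
  count-mono-< {xs = y ∷ xs} (there x∈) p ¬q with P? y | Q? y
  ... | yes _ | yes _ = s≤s (count-mono-< x∈ p ¬q)
  ... | yes _ | no  _ = m≤n⇒m≤1+n (count-mono-< x∈ p ¬q)
  ... | no ¬p | yes q = contradiction (Q⇒P q) ¬p
  ... | no  _ | no  _ = count-mono-< x∈ p ¬q

_⊨_ : (ℕ → Bool) → PF → Set
v ⊨ φ = ⟦ φ ⟧ v ≡ true

⇒'-intro : ∀ φ ψ → (v ⊨ φ → v ⊨ ψ) → v ⊨ (φ ⇒' ψ)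
⇒'-intro {v} φ ψ h with ⟦ φ ⟧ v
... | false = refl
... | true  = h refl

⇒'-elim : ∀ φ ψ → v ⊨ (φ ⇒' ψ) → v ⊨ φ → v ⊨ ψ
⇒'-elim {v} φ ψ h φ-holds with ⟦ φ ⟧ v | φ-holds
... | true | refl = h

⇒'-refl : ∀ φ → Taut (φ ⇒' φ)
⇒'-refl φ v = ⇒'-intro φ φ (λ h → h)

⇒'-trans : ∀ φ ψ χ → Taut (φ ⇒' ψ) → Taut (ψ ⇒' χ) → Taut (φ ⇒' χ)
⇒'-trans φ ψ χ φψ ψχ v = ⇒'-intro φ χ (⇒'-elim ψ χ (ψχ v) ∘ ⇒'-elim φ ψ (φψ v))

⊨disjF⁻ : ∀ A → v ⊨ disjF A → Any (λ l → v ⊨ litF l) A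
⊨disjF⁻ {v} (l ∷ A) h with ⟦ litF l ⟧ v in eq
... | true  = here eq
... | false = there (⊨disjF⁻ A h)

⊨disjF⁺ : ∀ A → Any (λ l → v ⊨ litF l) A → v ⊨ disjF A
⊨disjF⁺ (l ∷ A) (here h) rewrite h = refl
⊨disjF⁺ {v} (l ∷ A) (there h) with ⟦ litF l ⟧ v
... | true  = refl
... | false = ⊨disjF⁺ A h

⊨conjF⁻ : ∀ A → v ⊨ conjF A → All (λ l → v ⊨ litF l) A
⊨conjF⁻ [] _ = []
⊨conjF⁻ {v} (l ∷ A) h with ⟦ litF l ⟧ v in eq
... | true = eq ∷ ⊨conjF⁻ A h

⊨conjF⁺ : ∀ A → All (λ l → v ⊨ litF l) A → v ⊨ conjF A
⊨conjF⁺ [] [] = refl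
⊨conjF⁺ (l ∷ A) (h ∷ hs) rewrite h = ⊨conjF⁺ A hs

disjF-mono : A ⊆ B → Taut (disjF A ⇒' disjF B)
disjF-mono {A} {B} A⊆B v = ⇒'-intro (disjF A) (disjF B) (⊨disjF⁺ B ∘ Any-resp-⊆ A⊆B ∘ ⊨disjF⁻ A)

conjF-antitone : A ⊆ B → Taut (conjF B ⇒' conjF A)
conjF-antitone {A} {B} A⊆B v = ⇒'-intro (conjF B) (conjF A) (⊨conjF⁺ A ∘ anti-mono A⊆B ∘ ⊨conjF⁻ B)

atomBound : PF → ℕ
atomBound (atom n) = suc n
atomBound tt       = 0
atomBound ff       = 0
atomBound (φ ⇒' ψ) = atomBound φ ⊔ atomBound ψ
atomBound (φ ∧' ψ) = atomBound φ ⊔ atomBound ψ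
atomBound (φ ∨' ψ) = atomBound φ ⊔ atomBound ψ

⟦⟧-cong-below : ∀ φ {v w} → (∀ {n} → n < atomBound φ → v n ≡ w n) → ⟦ φ ⟧ v ≡ ⟦ φ ⟧ w
⟦⟧-cong-below (atom n) eq = eq ≤-refl
⟦⟧-cong-below tt       eq = refl
⟦⟧-cong-below ff       eq = refl
⟦⟧-cong-below (φ ⇒' ψ) eq =
  cong₂ (λ a b → not a ∨ b)
    (⟦⟧-cong-below φ (eq ∘ m<n⇒m<n⊔o _)) (⟦⟧-cong-below ψ (eq ∘ m<n⇒m<o⊔n _))
⟦⟧-cong-below (φ ∧' ψ) eq =
  cong₂ _∧_ (⟦⟧-cong-below φ (eq ∘ m<n⇒m<n⊔o _)) (⟦⟧-cong-below ψ (eq ∘ m<n⇒m<o⊔n _))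
⟦⟧-cong-below (φ ∨' ψ) eq =
  cong₂ _∨_ (⟦⟧-cong-below φ (eq ∘ m<n⇒m<n⊔o _)) (⟦⟧-cong-below ψ (eq ∘ m<n⇒m<o⊔n _))

valuation : Vec Bool k → ℕ → Bool
valuation {k} bs n with n <? k
... | yes n<k = Vec.lookup bs (fromℕ< n<k)
... | no  _   = false

valuation-tabulate : ∀ {n} → n < k → valuation (tabulate {n = k} (v ∘ toℕ)) n ≡ v n
valuation-tabulate {k} {v} {n} n<k with n <? k
... | yes n<k′ = trans (lookup∘tabulate (v ∘ toℕ) (fromℕ< n<k′)) (cong v (toℕ-fromℕ< n<k′))
... | no  n≮k  = contradiction n<k n≮k

taut? : ∀ φ → Dec (Taut φ)
taut? φ with anySubset? {n = atomBound φ} (λ bs → ¬? (⟦ φ ⟧ (valuation bs) Bool.≟ true))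
... | yes (bs , refuted) = no λ taut → refuted (taut (valuation bs))
... | no unrefuted = yes valid
  where
  valid : Taut φ
  valid v = begin
    ⟦ φ ⟧ v                 ≡⟨ ⟦⟧-cong-below φ (sym ∘ valuation-tabulate) ⟩
    ⟦ φ ⟧ (valuation bs)    ≡⟨ decidable-stable (_ Bool.≟ true) (λ refuted → unrefuted (bs , refuted)) ⟩
    true                    ∎
    where
    open ≡-Reasoning
    bs = tabulate {n = atomBound φ} (v ∘ toℕ)

subsumes-trans : ∀ c d r → Subsumes c d → Subsumes d r → Subsumes c r
subsumes-trans (init A) (init B) (init C) AB BC = ⇒'-trans (disjF A) (disjF B) (disjF C) AB BC
subsumes-trans (step C₁ A₁) (step C₂ A₂) (step C₃ A₃) (C₂C₁ , A₁A₂) (C₃C₂ , A₂A₃) =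
  ⇒'-trans (conjF C₃) (conjF C₂) (conjF C₁) C₃C₂ C₂C₁ ,
  ⇒'-trans (disjF A₁) (disjF A₂) (disjF A₃) A₁A₂ A₂A₃
subsumes-trans (some C₁ l₁) (some C₂ l₂) (some C₃ l₃) (C₂C₁ , l₁l₂) (C₃C₂ , l₂l₃) =
  ⇒'-trans (conjF C₃) (conjF C₂) (conjF C₁) C₃C₂ C₂C₁ ,
  ⇒'-trans (litF l₁) (litF l₂) (litF l₃) l₁l₂ l₂l₃
subsumes-trans (init _)   (step _ _) _ ()
subsumes-trans (init _)   (some _ _) _ ()
subsumes-trans (step _ _) (init _)   _ ()
subsumes-trans (step _ _) (some _ _) _ ()
subsumes-trans (some _ _) (init _)   _ ()
subsumes-trans (some _ _) (step _ _) _ ()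
subsumes-trans (init _)   (init _)   (step _ _) _ ()
subsumes-trans (init _)   (init _)   (some _ _) _ ()
subsumes-trans (step _ _) (step _ _) (init _)   _ ()
subsumes-trans (step _ _) (step _ _) (some _ _) _ ()
subsumes-trans (some _ _) (some _ _) (init _)   _ ()
subsumes-trans (some _ _) (some _ _) (step _ _) _ ()

subsumes? : ∀ c d → Dec (Subsumes c d)
subsumes? (init B)   (init A)   = taut? (disjF B ⇒' disjF A)
subsumes? (step D B) (step C A) = taut? (conjF C ⇒' conjF D) ×-dec taut? (disjF B ⇒' disjF A)
subsumes? (some D k) (some C l) = taut? (conjF C ⇒' conjF D) ×-dec taut? (litF k ⇒' litF l)
subsumes? (init _)   (step _ _) = no λ ()
subsumes? (init _)   (some _ _) = no λ ()
subsumes? (step _ _) (init _)   = no λ ()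
subsumes? (step _ _) (some _ _) = no λ ()
subsumes? (some _ _) (init _)   = no λ ()
subsumes? (some _ _) (step _ _) = no λ ()

subsumedBy? : ∀ S c → Dec (SubsumedBy S c)
subsumedBy? S c = any? (λ d → subsumes? d c) S

subsumedBy-trans : SubsumedBy S c → Subsumes c d → SubsumedBy S d
subsumedBy-trans {c = c} {d} s cd = Any.map (λ {e} ec → subsumes-trans e c d ec cd) s

subsumedBy-removeAt : ∀ S {i j : Fin (length S)} → i ≢ j → Subsumes (lookup S j) (lookup S i) →
                      SubsumedBy S c → SubsumedBy (removeAt S i) c
subsumedBy-removeAt S {i} {j} i≢j ji s with Any.index s Fin.≟ i
... | yes refl = lose (lookup-∈-removeAt S (i≢j ∘ sym)) (subsumes-trans _ _ _ ji (lookup-result s))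
... | no  index≢i = lose (lookup-∈-removeAt S index≢i) (lookup-result s)

-- Finitely many clauses up to subsumption

_≟ₗ_ : DecidableEquality Lit
pos m ≟ₗ pos n = Dec.map′ (cong pos) (λ { refl → refl }) (m ℕ.≟ n)
neg m ≟ₗ neg n = Dec.map′ (cong neg) (λ { refl → refl }) (m ℕ.≟ n)
pos _ ≟ₗ neg _ = no λ ()
neg _ ≟ₗ pos _ = no λ ()

open import Data.List.Membership.DecPropositional _≟ₗ_ using (_∈?_)

Below : ℕ → List Lit → Set
Below M = All (λ l → symOf l < M)

literalsBelow : ℕ → List Lit
literalsBelow M = concatMap (λ n → pos n ∷ neg n ∷ []) (upTo M)

∈-literalsBelow : ∀ l → symOf l < M → l ∈ literalsBelow M
∈-literalsBelow (pos n) n<M = ∈-concatMap⁺ _ (lose (∈-upTo⁺ n<M) (here refl))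
∈-literalsBelow (neg n) n<M = ∈-concatMap⁺ _ (lose (∈-upTo⁺ n<M) (there (here refl)))

normalise : ℕ → List Lit → List Lit
normalise M A = filter (_∈? A) (literalsBelow M)

normalise-⊆ : ∀ M A → normalise M A ⊆ A
normalise-⊆ M A = proj₂ ∘ ∈-filter⁻ (_∈? A) {xs = literalsBelow M}

⊆-normalise : Below M A → A ⊆ normalise M A
⊆-normalise {A = A} below l∈A = ∈-filter⁺ (_∈? A) (∈-literalsBelow _ (All.lookup below l∈A)) l∈A

normaliseClause : ℕ → Clause → Clause
normaliseClause M (init A)   = init (normalise M A)
normaliseClause M (step C A) = step (normalise M C) (normalise M A)
normaliseClause M (some C l) = some (normalise M C) l

literalSetsBelow : ℕ → List (List Lit)
literalSetsBelow M = sublists (literalsBelow M)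

normalise-∈-literalSetsBelow : ∀ M A → normalise M A ∈ literalSetsBelow M
normalise-∈-literalSetsBelow M A = filter-∈-sublists (_∈? A) (literalsBelow M)

clausesBelow : ℕ → List Clause
clausesBelow M =
  map init (literalSetsBelow M)
  ++ cartesianProductWith step (literalSetsBelow M) (literalSetsBelow M)
  ++ cartesianProductWith some (literalSetsBelow M) (literalsBelow M)

Bounded : ℕ → Clause → Set
Bounded N (init A)   = Below (3 ℕ.* N) A
Bounded N (step C A) = Below (3 ℕ.* N) C × Below (3 ℕ.* N) A
Bounded N (some C l) = Below (3 ℕ.* N) C × symOf l < N

m<n⇒m<3n : ∀ {m n} → m < n → m < 3 ℕ.* n
m<n⇒m<3n {n = n} m<n = <-≤-trans m<n (m≤n*m n 3)

normaliseClause-∈ : ∀ c → Bounded N c → normaliseClause (3 ℕ.* N) c ∈ clausesBelow (3 ℕ.* N)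
normaliseClause-∈ {N} (init A) _ = ∈-++⁺ˡ (∈-map⁺ init (normalise-∈-literalSetsBelow (3 ℕ.* N) A))
normaliseClause-∈ {N} (step C A) _ =
  ∈-++⁺ʳ (map init (literalSetsBelow 3N)) (∈-++⁺ˡ
    (∈-cartesianProductWith⁺ step (normalise-∈-literalSetsBelow 3N C) (normalise-∈-literalSetsBelow 3N A)))
  where 3N = 3 ℕ.* N
normaliseClause-∈ {N} (some C l) (_ , l<N) =
  ∈-++⁺ʳ (map init (literalSetsBelow 3N))
    (∈-++⁺ʳ (cartesianProductWith step (literalSetsBelow 3N) (literalSetsBelow 3N))
    (∈-cartesianProductWith⁺ some (normalise-∈-literalSetsBelow 3N C) (∈-literalsBelow l (m<n⇒m<3n l<N))))
  where 3N = 3 ℕ.* N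

normaliseClause-subsumes : ∀ M c → Subsumes (normaliseClause M c) c
normaliseClause-subsumes M (init A)   = disjF-mono (normalise-⊆ M A)
normaliseClause-subsumes M (step C A) = conjF-antitone (normalise-⊆ M C) , disjF-mono (normalise-⊆ M A)
normaliseClause-subsumes M (some C l) = conjF-antitone (normalise-⊆ M C) , ⇒'-refl (litF l)

subsumes-normaliseClause : ∀ c → Bounded N c → Subsumes c (normaliseClause (3 ℕ.* N) c)
subsumes-normaliseClause (init A)   A<             = disjF-mono (⊆-normalise A<)
subsumes-normaliseClause (step C A) (C< , A<)      = conjF-antitone (⊆-normalise C<) , disjF-mono (⊆-normalise A<)
subsumes-normaliseClause (some C l) (C< , _)       = conjF-antitone (⊆-normalise C<) , ⇒'-refl (litF l)

unsubsumed : ℕ → List Clause → ℕ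
unsubsumed M S = count (¬? ∘ subsumedBy? S) (clausesBelow M)

unsubsumed-antitone : (∀ {c} → SubsumedBy S c → SubsumedBy S′ c) → unsubsumed M S′ ≤ unsubsumed M S
unsubsumed-antitone {S} {S′} {M} S⇒S′ =
  count-mono (¬? ∘ subsumedBy? S) (¬? ∘ subsumedBy? S′) (λ ¬s′ s → ¬s′ (S⇒S′ s)) (clausesBelow M)

unsubsumed-< : S ⊆ S′ → Bounded N d → d ∈ S′ → ¬ SubsumedBy S d →
               unsubsumed (3 ℕ.* N) S′ < unsubsumed (3 ℕ.* N) S
unsubsumed-< {S} {S′} {N} {d} S⊆S′ bounded d∈S′ new =
  count-mono-< (¬? ∘ subsumedBy? S) (¬? ∘ subsumedBy? S′) (λ ¬s′ s → ¬s′ (Any-resp-⊆ S⊆S′ s))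
    (normaliseClause-∈ d bounded)
    (λ s → new (subsumedBy-trans s (normaliseClause-subsumes (3 ℕ.* N) d)))
    (λ ¬s′ → ¬s′ (lose d∈S′ (subsumes-normaliseClause d bounded)))

unsubsumed-removeAt : ∀ S {i j : Fin (length S)} → i ≢ j → Subsumes (lookup S j) (lookup S i) →
                      unsubsumed M (removeAt S i) ≡ unsubsumed M S
unsubsumed-removeAt {M} S {i} i≢j ji =
  ≤-antisym (unsubsumed-antitone {M = M} (subsumedBy-removeAt S i≢j ji))
            (unsubsumed-antitone {M = M} (Any-resp-⊆ (removeAt-⊆ S i)))

-- Symbol bounds

removeL-⊆ : ∀ p A → removeL p A ⊆ A
removeL-⊆ p (x ∷ A) with eqL x p
... | true  = there ∘ removeL-⊆ p A
... | false = λ { (here eq) → here eq ; (there m) → there (removeL-⊆ p A m) }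

dedupL-⊆ : ∀ A → dedupL A ⊆ A
dedupL-⊆ = ∈-deduplicate⁻ (T? ∘₂ eqL)

removeL-Below : ∀ p A → Below M A → Below M (removeL p A)
removeL-Below p A = anti-mono (removeL-⊆ p A)

dedupL-Below : ∀ A → Below M A → Below M (dedupL A)
dedupL-Below A = anti-mono (dedupL-⊆ A)

negC-Below : Below M A → Below M (negC A)
negC-Below = map⁺ ∘ All.map λ { {pos _} l<M → l<M ; {neg _} l<M → l<M }

simp-Bounded : ∀ c → Bounded N c → All (Bounded N) (simp c)
simp-Bounded (init A) A< = dedupL-Below A A< ∷ []
simp-Bounded (step C A) (C< , A<) with hasComp C | hasComp A | dedupL A | dedupL-Below A A<
... | true  | _     | _       | _   = []
... | false | true  | _       | _   = []
... | false | false | []      | _   = negC-Below C′< ∷ ([] , negC-Below C′<) ∷ []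
  where C′< = dedupL-Below C C<
... | false | false | (_ ∷ _) | A′< = (dedupL-Below C C< , A′<) ∷ []
simp-Bounded (some C l) (C< , l<N) = (dedupL-Below C C< , l<N) ∷ []

Resolvent-Bounded : All (Bounded N) S → Resolvent S r → Bounded N r
Resolvent-Bounded bounded (init-res {A} {B} p A∈S B∈S _ _) =
  ++⁺ (removeL-Below p A (All.lookup bounded A∈S)) (removeL-Below (comp p) B (All.lookup bounded B∈S))
Resolvent-Bounded bounded (step-res {A = A} {B = B} p CA∈S DB∈S _ _)
  with All.lookup bounded CA∈S | All.lookup bounded DB∈S
... | C< , A< | D< , B< = ++⁺ C< D< , ++⁺ (removeL-Below p A A<) (removeL-Below (comp p) B B<)

SNFm-Below : All (Bounded N) S → ∀ {A Bs} → SNFm S A Bs → Below (3 ℕ.* N) A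
SNFm-Below bounded (base AB∈S) = proj₁ (All.lookup bounded AB∈S)
SNFm-Below bounded (comb AC BD) = ++⁺ (SNFm-Below bounded AC) (SNFm-Below bounded BD)

sometimesFor-Below : ∀ l S → All (Bounded N) S → All (Below (3 ℕ.* N)) (sometimesFor l S)
sometimesFor-Below l [] [] = []
sometimesFor-Below l (init _ ∷ S)   (_ ∷ bounded) = sometimesFor-Below l S bounded
sometimesFor-Below l (step _ _ ∷ S) (_ ∷ bounded) = sometimesFor-Below l S bounded
sometimesFor-Below l (some C k ∷ S) ((C< , _) ∷ bounded) with eqL k l
... | true  = C< ∷ sometimesFor-Below l S bounded
... | false = sometimesFor-Below l S bounded

wSym<3N : ∀ l → symOf l < N → wSym N l < 3 ℕ.* N
wSym<3N {N} (pos n) n<N = +-monoʳ-< N (*-monoʳ-< 2 n<N)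
wSym<3N {N} (neg n) n<N = +-monoʳ-< N (subst (_≤ 2 ℕ.* N) (*-suc 2 n) (*-monoʳ-≤ 2 n<N))

loopRes-Bounded : ∀ {wl} L → Below (3 ℕ.* N) C → symOf l < N → wl < 3 ℕ.* N →
                  All (Below (3 ℕ.* N) ∘ proj₁) (toList L) → All (Bounded N) (loopRes C l wl L)
loopRes-Bounded {N = N} {C = C} {l = l} {wl} L C< l<N wl< As< = concatMap⁺ (λ {AB} → bounds {AB}) As<
  where
  bounds : ∀ {AB : List Lit × List (List Lit)} → Below (3 ℕ.* N) (proj₁ AB) →
           All (Bounded N) (init (negC C ++ l ∷ negC (proj₁ AB)) ∷ step [] (negC C ++ l ∷ negC (proj₁ AB))
                            ∷ step (pos wl ∷ []) (l ∷ negC (proj₁ AB)) ∷ [])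
  bounds A< = let D< = ++⁺ (negC-Below C<) (m<n⇒m<3n l<N ∷ negC-Below A<)
              in D< ∷ ([] , D<) ∷ ((wl< ∷ []) , (m<n⇒m<3n l<N ∷ negC-Below A<)) ∷ []

allLoopRes-Bounded : ∀ Ls → All (Bounded N) S → some C l ∈ S → All (IsLoop S l) Ls →
                     All (Bounded N) (allLoopRes S l (wSym N l) Ls)
allLoopRes-Bounded {N} {S} {l = l} Ls bounded some∈S loops =
  concatMap⁺ (simp-Bounded _)
    (concatMap⁺ (λ C< → concatMap⁺ (loop-Bounded C<) loops) (sometimesFor-Below l S bounded))
  where
  l<N = proj₂ (All.lookup bounded some∈S)

  loop-Bounded : ∀ {C L} → Below (3 ℕ.* N) C → IsLoop S l L → All (Bounded N) (loopRes C l (wSym N l) L)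
  loop-Bounded {L = L} C< loop = loopRes-Bounded L C< l<N (wSym<3N l l<N) (All.map (SNFm-Below bounded ∘ proj₁) loop)

someClauses-Bounded : ∀ S → All (Bounded N) S → All (Bounded N ∘ uncurry some) (someClauses S)
someClauses-Bounded [] [] = []
someClauses-Bounded (init _ ∷ S)   (_ ∷ bounded) = someClauses-Bounded S bounded
someClauses-Bounded (step _ _ ∷ S) (_ ∷ bounded) = someClauses-Bounded S bounded
someClauses-Bounded (some _ _ ∷ S) (b ∷ bounded) = b ∷ someClauses-Bounded S bounded

Aug-Bounded : ∀ As → All (Bounded N) As → All (Bounded N) (Aug N As)
Aug-Bounded {N} As bounded =
  ++⁺ bounded (++⁺ (map⁺ (All.map wClause-Bounded eventualities<N)) (concatMap⁺ augClauses-Bounded sometimes<))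
  where
  sometimes< : All (Bounded N ∘ uncurry some) (someClauses As)
  sometimes< = someClauses-Bounded As bounded

  eventualities<N : Below N (eventualities As)
  eventualities<N = dedupL-Below _ (map⁺ (All.map proj₂ sometimes<))

  wClause-Bounded : ∀ {l} → symOf l < N → Bounded N (step (pos (wSym N l) ∷ []) (l ∷ pos (wSym N l) ∷ []))
  wClause-Bounded {l} l<N = (wSym<3N l l<N ∷ []) , (m<n⇒m<3n l<N ∷ wSym<3N l l<N ∷ [])

  augClauses-Bounded : ∀ {Cl} → Bounded N (uncurry some Cl) →
    All (Bounded N) (init (negC (proj₁ Cl) ++ proj₂ Cl ∷ pos (wSym N (proj₂ Cl)) ∷ [])
                     ∷ step [] (negC (proj₁ Cl) ++ proj₂ Cl ∷ pos (wSym N (proj₂ Cl)) ∷ []) ∷ [])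
  augClauses-Bounded {C , l} (C< , l<N) =
    let D< = ++⁺ (negC-Below C<) (m<n⇒m<3n l<N ∷ wSym<3N l l<N ∷ []) in D< ∷ ([] , D<) ∷ []

Below-maxLits : ∀ A → maxLits A < M → Below M A
Below-maxLits [] _ = []
Below-maxLits (l ∷ A) h = m⊔n<o⇒m<o _ _ h ∷ Below-maxLits A (m⊔n<o⇒n<o _ _ h)

maxSym-Bounded : ∀ S → maxSym S < N → All (Bounded N) S
maxSym-Bounded [] _ = []
maxSym-Bounded (init A ∷ S) h =
  Below-maxLits A (m<n⇒m<3n (m⊔n<o⇒m<o _ _ h)) ∷ maxSym-Bounded S (m⊔n<o⇒n<o _ _ h)
maxSym-Bounded (step C A ∷ S) h =
  (Below-maxLits C (m<n⇒m<3n (m⊔n<o⇒m<o _ _ CA<)) , Below-maxLits A (m<n⇒m<3n (m⊔n<o⇒n<o _ _ CA<)))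
  ∷ maxSym-Bounded S (m⊔n<o⇒n<o _ _ h)
  where CA< = m⊔n<o⇒m<o _ _ h
maxSym-Bounded (some C l ∷ S) h =
  (Below-maxLits C (m<n⇒m<3n (m⊔n<o⇒m<o _ _ Cl<)) , m⊔n<o⇒n<o _ _ Cl<)
  ∷ maxSym-Bounded S (m⊔n<o⇒n<o _ _ h)
  where Cl< = m⊔n<o⇒m<o _ _ h

module _ {St Rk : Set} {_⇝_ : St → St → Set} {_<ᵣ_ : Rk → Rk → Set}
         (rank : St → Rk) (Inv : St → Set)
         (decreasing : ∀ {s t} → Inv s → s ⇝ t → Inv t × rank t <ᵣ rank s) where

  acc-by-rank : ∀ {s} → Acc _<ᵣ_ (rank s) → Inv s → Acc (flip _⇝_) s
  acc-by-rank (acc smaller) inv = acc λ s⇝t →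
    let inv′ , t<s = decreasing inv s⇝t in acc-by-rank (smaller t<s) inv′

Rank : Set
Rank = ℕ × ℕ × ℕ

_<ʳ_ : Rank → Rank → Set
_<ʳ_ = ×-Lex _≡_ _<_ (×-Lex _≡_ _<_ _<_)

<ʳ-wellFounded : WellFounded _<ʳ_
<ʳ-wellFounded = ×-wellFounded <-wellFounded (×-wellFounded <-wellFounded <-wellFounded)

halted<ʳ : ∀ μ k n → (0 , 0 , 0) <ʳ (μ , suc k , n)
halted<ʳ zero    k n = inj₂ (refl , inj₁ z<s)
halted<ʳ (suc μ) k n = inj₁ z<s

Unresolved : List Lit → Clause → Set
Unresolved R (some _ l) = l ∉ R
Unresolved R _          = ⊥

unresolved? : ∀ R c → Dec (Unresolved R c)
unresolved? R (init _)   = no λ ()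
unresolved? R (step _ _) = no λ ()
unresolved? R (some _ l) = ¬? (l ∈? R)

Unresolved-∷ : ∀ c → Unresolved (l ∷ R) c → Unresolved R c
Unresolved-∷ (some _ k) k∉l∷R = k∉l∷R ∘ there

rank : State → Rank
rank (phase3 N S)   = unsubsumed (3 ℕ.* N) S , 2 , length S
rank (phase4 N S R) = unsubsumed (3 ℕ.* N) S , 1 , count (unresolved? R) S
rank unsat          = 0 , 0 , 0
rank sat            = 0 , 0 , 0

Invariant : State → Set
Invariant (phase3 N S)   = All (Bounded N) S
Invariant (phase4 N S _) = All (Bounded N) S
Invariant unsat          = ⊤
Invariant sat            = ⊤

step-decreasing : ∀ {s t} → Invariant s → s ⟶ t → Invariant t × rank t <ʳ rank s
step-decreasing _ (derived-false _) = tt , halted<ʳ _ _ _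
step-decreasing bounded (resolve {r = r} _ res d∈simp new) =
  d< ∷ bounded , inj₁ (unsubsumed-< (xs⊆x∷xs _ _) d< (here refl) new)
  where d< = All.lookup (simp-Bounded r (Resolvent-Bounded bounded res)) d∈simp
step-decreasing bounded (subsume {N} {S} i j i≢j ji) =
  anti-mono (removeAt-⊆ S i) bounded ,
  inj₂ (unsubsumed-removeAt {3 ℕ.* N} S i≢j ji , inj₂ (refl , ≤-reflexive (sym (length-removeAt′ S i))))
step-decreasing bounded (saturated _ _) = bounded , inj₂ (refl , inj₁ (s≤s (s≤s z≤n)))
step-decreasing bounded (loop-new {S = S} Ls some∈S _ loops new) with find new
... | d , d∈L , d-new =
  ++⁺ L< bounded , inj₁ (unsubsumed-< (xs⊆ys++xs S _) (All.lookup L< d∈L) (∈-++⁺ˡ d∈L) d-new)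
  where L< = allLoopRes-Bounded Ls bounded some∈S loops
step-decreasing bounded (loop-old {S = S} {R = R} _ some∈S l∉R _ _) =
  bounded , inj₂ (refl , inj₂ (refl ,
    count-mono-< (unresolved? R) (unresolved? (_ ∷ R)) (λ {c} → Unresolved-∷ c)
      some∈S l∉R (λ l∉l∷R → l∉l∷R (here refl))))
step-decreasing _ (all-resolved _) = tt , halted<ʳ _ _ _

-- Progress

clashing : List Lit → List Lit → List Lit
clashing A B = filter (λ p → comp p ∈? B) A

∈-clashing⁺ : ∀ {p} → p ∈ A → comp p ∈ B → p ∈ clashing A B
∈-clashing⁺ {B = B} = ∈-filter⁺ (λ p → comp p ∈? B)

∈-clashing⁻ : ∀ {p} → p ∈ clashing A B → p ∈ A × comp p ∈ B
∈-clashing⁻ {B = B} = ∈-filter⁻ (λ p → comp p ∈? B)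

resolventsOf : Clause → Clause → List Clause
resolventsOf (init A)   (init B)   = map (λ p → init (removeL p A ++ removeL (comp p) B)) (clashing A B)
resolventsOf (step C A) (step D B) = map (λ p → step (C ++ D) (removeL p A ++ removeL (comp p) B)) (clashing A B)
resolventsOf _          _          = []

resolvents : List Clause → List Clause
resolvents S = concat (cartesianProductWith resolventsOf S S)

resolventsOf-sound : ∀ c d → c ∈ S → d ∈ S → r ∈ resolventsOf c d → Resolvent S r
resolventsOf-sound (init A) (init B) c∈S d∈S r∈ with ∈-map⁻ _ r∈
... | p , p∈ , refl = let p∈A , p̅∈B = ∈-clashing⁻ p∈ in init-res p c∈S d∈S p∈A p̅∈B
resolventsOf-sound (step C A) (step D B) c∈S d∈S r∈ with ∈-map⁻ _ r∈
... | p , p∈ , refl = let p∈A , p̅∈B = ∈-clashing⁻ p∈ in step-res p c∈S d∈S p∈A p̅∈B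
resolventsOf-sound (init _)   (step _ _) _ _ ()
resolventsOf-sound (init _)   (some _ _) _ _ ()
resolventsOf-sound (step _ _) (init _)   _ _ ()
resolventsOf-sound (step _ _) (some _ _) _ _ ()
resolventsOf-sound (some _ _) _          _ _ ()

resolvents-sound : r ∈ resolvents S → Resolvent S r
resolvents-sound {S = S} r∈ with ∈-concat⁻′ (cartesianProductWith resolventsOf S S) r∈
... | rs , r∈rs , rs∈ with ∈-cartesianProductWith⁻ resolventsOf S S rs∈
... | c , d , c∈S , d∈S , refl = resolventsOf-sound c d c∈S d∈S r∈rs

resolvents-complete : Resolvent S r → r ∈ resolvents S
resolvents-complete (init-res p c∈S d∈S p∈A p̅∈B) =
  ∈-concat⁺′ (∈-map⁺ _ (∈-clashing⁺ p∈A p̅∈B)) (∈-cartesianProductWith⁺ resolventsOf c∈S d∈S)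
resolvents-complete (step-res p c∈S d∈S p∈A p̅∈B) =
  ∈-concat⁺′ (∈-map⁺ _ (∈-clashing⁺ p∈A p̅∈B)) (∈-cartesianProductWith⁺ resolventsOf c∈S d∈S)

NewResolvent : List Clause → Set
NewResolvent S = ∃₂ λ r d → Resolvent S r × d ∈ simp r × ¬ SubsumedBy S d

saturated⊎newResolvent : ∀ S → Saturated S ⊎ NewResolvent S
saturated⊎newResolvent S with all? (λ r → all? (subsumedBy? S) (simp r)) (resolvents S)
... | yes all-subsumed = inj₁ λ res d∈ → All.lookup (All.lookup all-subsumed (resolvents-complete res)) d∈
... | no ¬all-subsumed =
  let r , r∈ , ¬r-subsumed = find (¬All⇒Any¬ (λ r → all? (subsumedBy? S) (simp r)) _ ¬all-subsumed)
      d , d∈ , d-new       = find (¬All⇒Any¬ (subsumedBy? S) _ ¬r-subsumed)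
  in inj₂ (r , d , resolvents-sound r∈ , d∈ , d-new)

init[]≟ : ∀ c → Dec (init [] ≡ c)
init[]≟ (init [])      = yes refl
init[]≟ (init (_ ∷ _)) = no λ ()
init[]≟ (step _ _)     = no λ ()
init[]≟ (some _ _)     = no λ ()

concatMap-[] : ∀ (xs : List X) → concatMap {B = Y} (λ _ → []) xs ≡ []
concatMap-[] []       = refl
concatMap-[] (_ ∷ xs) = concatMap-[] xs

progress : ∀ s → Final s ⊎ ∃ (s ⟶_)
progress unsat = inj₁ tt
progress sat   = inj₁ tt
progress (phase3 N S) with any? init[]≟ S
... | yes false∈S = inj₂ (_ , derived-false false∈S)
... | no  false∉S with saturated⊎newResolvent S
...   | inj₁ saturated-S                   = inj₂ (_ , saturated false∉S saturated-S)
...   | inj₂ (_ , _ , res , d∈simp , new) = inj₂ (_ , resolve false∉S res d∈simp new)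
progress (phase4 N S R) with any? (unresolved? R) S
... | no none-unresolved =
  inj₂ (_ , all-resolved λ {_} {l} some∈S → decidable-stable (l ∈? R) (none-unresolved ∘ lose some∈S))
... | yes some-unresolved with find some-unresolved
...   | some C l , some∈S , l∉R =
  -- A loop search may find no loops; then there is no new loop resolvent and ◇ l is resolved.
  inj₂ (_ , loop-old [] some∈S l∉R [] (subst (All (SubsumedBy S)) (sym no-loop-resolvents) []))
  where
  no-loop-resolvents : allLoopRes S l (wSym N l) [] ≡ []
  no-loop-resolvents = cong (concatMap simp) (concatMap-[] (sometimesFor l S))

terminates : ∀ {s} → Invariant s → Terminates s
terminates {s} inv =
  acc-by-rank rank Invariant step-decreasing (<ʳ-wellFounded (rank s)) inv , λ t _ → progress t

theorem5 : (τ₀ : Formula → List Clause) (A : Formula) → Terminates (initialState (τ₀ A))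
theorem5 τ₀ A = terminates (Aug-Bounded (τ₀ A) (maxSym-Bounded (τ₀ A) ≤-refl))
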